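{- Let $\beta$ be a peripheral arc in a triangulated annulus (with triangulation containing no peripheral arcs) such that the corresponding string module $M(\beta)$ is a rigid indecomposable representation of the quiver of the triangulation. Its support is a quiver of type $A$ with vertices ordered from left to right. Let $\alpha=\beta^{ -1}$ be the inverse string, obtained by reading $\beta$ from right to left. Let $a,b,c,d\ge 0$ be such that \[ \nabla(\beta)=\begin{pmatrix} \mathfrak{R}(\beta) & -\mathfrak{R}_1(\beta) \\ {_0}\mathfrak{R}(\beta) & -{_0}\mathfrak{R}_1(\beta) \end{pmatrix}=\begin{pmatrix} a & -b \\ c & -d\end{pmatrix}. \] Then \[ \nabla(\alpha)=\begin{pmatrix} a & c-a \\ a-b & c+b-a-d\end{pmatrix}. \]
   Context: For a sincere indecomposable module $M$ over a type $A$ quiver whose vertices are drawn left to right, the specialized rank matrix is $\nabla(M)=\begin{pmatrix} \mathfrak{R}(M) & -\mathfrak{R}_1(M) \\ {_0}\mathfrak{R}(M) & -{_0}\mathfrak{R}_1(M)\end{pmatrix}$. Here: - $\mathfrak{R}(M)$ is the number of submodules of $M$; - $\mathfrak{R}_1(M)$ is the number of submodules containing the rightmost vertex; - ${_0}\mathfrak{R}(M)$ is the number of submodules not containing the leftmost vertex; - ${_0}\mathfrak{R}_1(M)$ is the number of submodules containing the rightmost vertex but not the leftmost vertex. Submodules correspond to down-closed subsets (order ideals) of the associated fence poset. -}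

module Defs where

open import Data.Bool using (Bool; true; false; not; _∧_; _∨_; if_then_else_)
open import Data.Nat using (ℕ; zero; suc)
open import Data.Integer using (ℤ; +_; -_; _-_; _+_)
open import Data.List using (List; []; _∷_; map; _++_)
open import Data.Vec using (Vec; []; _∷_; reverse; head; last)
import Data.Vec as V

-- A string for a type A quiver with (suc n) vertices 0,…,n drawn left to right:
-- the i-th entry is the orientation of the arrow between vertex i and i+1;
-- true  = arrow points right  (i → i+1),
-- false = arrow points left   (i+1 → i).
-- The string module M(s) has a one-dimensional space at each vertex and
-- identity maps along the arrows (it is sincere and indecomposable).
StringA : ℕ → Set
StringA n = Vec Bool n

-- inverse string: read from right to left (vertices reversed, hence every
-- arrow now points in the opposite reading direction)
inverse : ∀ {n} → StringA n → StringA n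
inverse s = reverse (V.map not s)

allSubsets : (m : ℕ) → List (Vec Bool m)
allSubsets zero = [] ∷ []
allSubsets (suc m) = map (true ∷_) (allSubsets m) ++ map (false ∷_) (allSubsets m)

closedArrow : Bool → Bool → Bool → Bool
closedArrow true  x y = not x ∨ y   -- x → y : x ∈ S implies y ∈ S
closedArrow false x y = not y ∨ x   -- y → x : y ∈ S implies x ∈ S

-- a subset is (the support of) a submodule of M(s) iff it is closed under
-- the arrows (an order ideal of the associated fence poset)
isSubmodule : ∀ {n} → StringA n → Vec Bool (suc n) → Bool
isSubmodule []       (x ∷ [])     = true
isSubmodule (o ∷ os) (x ∷ y ∷ xs) = closedArrow o x y ∧ isSubmodule os (y ∷ xs)

count : ∀ {A : Set} → (A → Bool) → List A → ℕ
count p [] = 0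
count p (x ∷ xs) = if p x then suc (count p xs) else count p xs

𝔑 : ∀ {n} → StringA n → ℕ
𝔑 {n} s = count (isSubmodule s) (allSubsets (suc n))

𝔑₁ : ∀ {n} → StringA n → ℕ
𝔑₁ {n} s = count (λ S → isSubmodule s S ∧ last S) (allSubsets (suc n))

₀𝔑 : ∀ {n} → StringA n → ℕ
₀𝔑 {n} s = count (λ S → isSubmodule s S ∧ not (head S)) (allSubsets (suc n))

₀𝔑₁ : ∀ {n} → StringA n → ℕ
₀𝔑₁ {n} s = count (λ S → isSubmodule s S ∧ last S ∧ not (head S)) (allSubsets (suc n))

Mat2 : Set
Mat2 = Vec (Vec ℤ 2) 2

mat : ℤ → ℤ → ℤ → ℤ → Mat2
mat p q r t = (p ∷ q ∷ []) ∷ (r ∷ t ∷ []) ∷ []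

∇ : ∀ {n} → StringA n → Mat2
∇ s = mat (+ 𝔑 s) (- (+ 𝔑₁ s)) (+ ₀𝔑 s) (- (+ ₀𝔑₁ s))

-- Reversing vertex sets is a bijection on subsets, and it carries the submodules of M(β)
-- onto those of M(β⁻¹), exchanging the roles of the leftmost and rightmost vertices.
-- So 𝔑₁(α) counts the submodules of M(β) containing the leftmost vertex, which is
-- 𝔑(β) − ₀𝔑(β), and similarly for the other entries; the last entry follows by
-- inclusion-exclusion on the two end vertices. Neither the annulus nor rigidity plays
-- a role: the identity holds for every string.
module Submission where

open import Defs
open import Data.Bool using (Bool; true; false; not; _∧_)
open import Data.Bool.Properties using (∧-assoc; ∧-comm; ∧-identityʳ)
open import Data.Nat as ℕ using (ℕ; zero; suc)
open import Data.Nat.Properties using (+-suc; +-commutativeSemigroup)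
open import Algebra.Properties.CommutativeSemigroup +-commutativeSemigroup using (interchange)
open import Data.Integer using (ℤ; +_; -_; _-_; _+_)
open import Data.Integer.Properties using (pos-+; +-injective; neg-injective)
open import Data.Integer.Tactic.RingSolver using (solve-∀)
open import Data.List using (List; []; _∷_; map; _++_)
open import Data.Vec using (Vec; []; _∷_; reverse; head; last; _∷ʳ_)
import Data.Vec as Vec
open import Data.Vec.Properties using (reverse-∷; reverse-involutive; last-reverse)
open import Data.Product using (_×_; _,_)
open import Function using (_∘_)
open import Relation.Binary.PropositionalEquality
open ≡-Reasoning

count-++ : ∀ {A : Set} (p : A → Bool) (xs ys : List A) →
           count p (xs ++ ys) ≡ count p xs ℕ.+ count p ys
count-++ p []       ys = refl
count-++ p (x ∷ xs) ys with p x
... | true  = cong suc (count-++ p xs ys)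
... | false = count-++ p xs ys

count-map : ∀ {A B : Set} (p : B → Bool) (f : A → B) (xs : List A) →
            count p (map f xs) ≡ count (p ∘ f) xs
count-map p f []       = refl
count-map p f (x ∷ xs) with p (f x)
... | true  = cong suc (count-map p f xs)
... | false = count-map p f xs

count-cong : ∀ {A : Set} {p q : A → Bool} → (∀ x → p x ≡ q x) → (xs : List A) →
             count p xs ≡ count q xs
count-cong p≗q []       = refl
count-cong {q = q} p≗q (x ∷ xs) rewrite p≗q x with q x
... | true  = cong suc (count-cong p≗q xs)
... | false = count-cong p≗q xs

count-split : ∀ {A : Set} (p q : A → Bool) (xs : List A) →
              count p xs ≡ count (λ x → p x ∧ q x) xs ℕ.+ count (λ x → p x ∧ not (q x)) xs
count-split p q [] = refl
count-split p q (x ∷ xs) with p x | q x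
... | true  | true  = cong suc (count-split p q xs)
... | true  | false = trans (cong suc (count-split p q xs)) (sym (+-suc _ _))
... | false | _     = count-split p q xs

countSubsets : (m : ℕ) → (Vec Bool m → Bool) → ℕ
countSubsets m p = count p (allSubsets m)

countSubsets-cong : ∀ m {p q : Vec Bool m → Bool} → (∀ S → p S ≡ q S) →
                    countSubsets m p ≡ countSubsets m q
countSubsets-cong m p≗q = count-cong p≗q (allSubsets m)

countSubsets-∷ : ∀ m (p : Vec Bool (suc m) → Bool) →
                 countSubsets (suc m) p ≡ countSubsets m (p ∘ (true ∷_)) ℕ.+ countSubsets m (p ∘ (false ∷_))
countSubsets-∷ m p = begin
  count p (map (true ∷_) (allSubsets m) ++ map (false ∷_) (allSubsets m))
    ≡⟨ count-++ p (map (true ∷_) (allSubsets m)) (map (false ∷_) (allSubsets m)) ⟩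
  count p (map (true ∷_) (allSubsets m)) ℕ.+ count p (map (false ∷_) (allSubsets m))
    ≡⟨ cong₂ ℕ._+_ (count-map p (true ∷_) (allSubsets m)) (count-map p (false ∷_) (allSubsets m)) ⟩
  countSubsets m (p ∘ (true ∷_)) ℕ.+ countSubsets m (p ∘ (false ∷_)) ∎

countSubsets-∷ʳ : ∀ m (p : Vec Bool (suc m) → Bool) →
                  countSubsets (suc m) p ≡ countSubsets m (p ∘ (_∷ʳ true)) ℕ.+ countSubsets m (p ∘ (_∷ʳ false))
countSubsets-∷ʳ zero    p = countSubsets-∷ zero p
countSubsets-∷ʳ (suc m) p = begin
  countSubsets (suc (suc m)) p
    ≡⟨ countSubsets-∷ (suc m) p ⟩
  countSubsets (suc m) (p ∘ (true ∷_)) ℕ.+ countSubsets (suc m) (p ∘ (false ∷_))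
    ≡⟨ cong₂ ℕ._+_ (countSubsets-∷ʳ m (p ∘ (true ∷_))) (countSubsets-∷ʳ m (p ∘ (false ∷_))) ⟩
  (# true true ℕ.+ # true false) ℕ.+ (# false true ℕ.+ # false false)
    ≡⟨ interchange (# true true) (# true false) (# false true) (# false false) ⟩
  (# true true ℕ.+ # false true) ℕ.+ (# true false ℕ.+ # false false)
    ≡⟨ sym (cong₂ ℕ._+_ (countSubsets-∷ m (p ∘ (_∷ʳ true))) (countSubsets-∷ m (p ∘ (_∷ʳ false)))) ⟩
  countSubsets (suc m) (p ∘ (_∷ʳ true)) ℕ.+ countSubsets (suc m) (p ∘ (_∷ʳ false)) ∎
  where
  # : Bool → Bool → ℕ
  # x y = countSubsets m (λ S → p (x ∷ (S ∷ʳ y)))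

countSubsets-reverse : ∀ m (p : Vec Bool m → Bool) → countSubsets m p ≡ countSubsets m (p ∘ reverse)
countSubsets-reverse zero    p = refl
countSubsets-reverse (suc m) p = begin
  countSubsets (suc m) p
    ≡⟨ countSubsets-∷ʳ m p ⟩
  countSubsets m (p ∘ (_∷ʳ true)) ℕ.+ countSubsets m (p ∘ (_∷ʳ false))
    ≡⟨ cong₂ ℕ._+_ (countSubsets-reverse m (p ∘ (_∷ʳ true))) (countSubsets-reverse m (p ∘ (_∷ʳ false))) ⟩
  countSubsets m (λ S → p (reverse S ∷ʳ true)) ℕ.+ countSubsets m (λ S → p (reverse S ∷ʳ false))
    ≡⟨ sym (cong₂ ℕ._+_ (countSubsets-cong m (cong p ∘ reverse-∷ true))
                        (countSubsets-cong m (cong p ∘ reverse-∷ false))) ⟩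
  countSubsets m (p ∘ reverse ∘ (true ∷_)) ℕ.+ countSubsets m (p ∘ reverse ∘ (false ∷_))
    ≡⟨ sym (countSubsets-∷ m (p ∘ reverse)) ⟩
  countSubsets (suc m) (p ∘ reverse) ∎

head-reverse : ∀ {m} (S : Vec Bool (suc m)) → head (reverse S) ≡ last S
head-reverse S = trans (sym (last-reverse (reverse S))) (cong last (reverse-involutive S))

isSubmodule-∷ʳ : ∀ {n} (s : StringA n) (o : Bool) (S : Vec Bool (suc n)) (x : Bool) →
                 isSubmodule (s ∷ʳ o) (S ∷ʳ x) ≡ isSubmodule s S ∧ closedArrow o (last S) x
isSubmodule-∷ʳ []       o (y ∷ [])     x = ∧-identityʳ _
isSubmodule-∷ʳ (o′ ∷ s) o (y ∷ y′ ∷ S) x =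
  trans (cong (closedArrow o′ y y′ ∧_) (isSubmodule-∷ʳ s o (y′ ∷ S) x))
        (sym (∧-assoc (closedArrow o′ y y′) _ _))

closedArrow-not : ∀ o x y → closedArrow (not o) y x ≡ closedArrow o x y
closedArrow-not true  x y = refl
closedArrow-not false x y = refl

isSubmodule-inverse : ∀ {n} (s : StringA n) (S : Vec Bool (suc n)) →
                      isSubmodule (inverse s) (reverse S) ≡ isSubmodule s S
isSubmodule-inverse []      (x ∷ [])     = refl
isSubmodule-inverse (o ∷ s) (x ∷ y ∷ S) = begin
  isSubmodule (reverse (Vec.map not (o ∷ s))) (reverse (x ∷ y ∷ S))
    ≡⟨ cong₂ isSubmodule (reverse-∷ (not o) (Vec.map not s)) (reverse-∷ x (y ∷ S)) ⟩
  isSubmodule (inverse s ∷ʳ not o) (reverse (y ∷ S) ∷ʳ x)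
    ≡⟨ isSubmodule-∷ʳ (inverse s) (not o) (reverse (y ∷ S)) x ⟩
  isSubmodule (inverse s) (reverse (y ∷ S)) ∧ closedArrow (not o) (last (reverse (y ∷ S))) x
    ≡⟨ cong₂ _∧_ (isSubmodule-inverse s (y ∷ S))
                 (trans (cong (λ z → closedArrow (not o) z x) (last-reverse (y ∷ S))) (closedArrow-not o x y)) ⟩
  isSubmodule s (y ∷ S) ∧ closedArrow o x y
    ≡⟨ ∧-comm (isSubmodule s (y ∷ S)) (closedArrow o x y) ⟩
  closedArrow o x y ∧ isSubmodule s (y ∷ S) ∎

submodulesWith : ∀ {n} → StringA n → (Vec Bool (suc n) → Bool) → ℕ
submodulesWith {n} s P = countSubsets (suc n) (λ S → isSubmodule s S ∧ P S)

submodulesWith-cong : ∀ {n} (s : StringA n) {P Q : Vec Bool (suc n) → Bool} → (∀ S → P S ≡ Q S) →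
                      submodulesWith s P ≡ submodulesWith s Q
submodulesWith-cong {n} s P≗Q = countSubsets-cong (suc n) (cong (isSubmodule s _ ∧_) ∘ P≗Q)

submodulesWith-split : ∀ {n} (s : StringA n) (P Q : Vec Bool (suc n) → Bool) →
                       submodulesWith s P ≡ submodulesWith s (λ S → P S ∧ Q S) ℕ.+ submodulesWith s (λ S → P S ∧ not (Q S))
submodulesWith-split {n} s P Q = trans
  (count-split (λ S → isSubmodule s S ∧ P S) Q (allSubsets (suc n)))
  (cong₂ ℕ._+_ (countSubsets-cong (suc n) (λ S → ∧-assoc (isSubmodule s S) (P S) (Q S)))
               (countSubsets-cong (suc n) (λ S → ∧-assoc (isSubmodule s S) (P S) (not (Q S)))))

submodulesWith-inverse : ∀ {n} (s : StringA n) (P : Vec Bool (suc n) → Bool) →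
                         submodulesWith (inverse s) P ≡ submodulesWith s (P ∘ reverse)
submodulesWith-inverse {n} s P = trans
  (countSubsets-reverse (suc n) (λ S → isSubmodule (inverse s) S ∧ P S))
  (countSubsets-cong (suc n) (λ S → cong (_∧ P (reverse S)) (isSubmodule-inverse s S)))

𝔑-inverse : ∀ {n} (s : StringA n) → 𝔑 (inverse s) ≡ 𝔑 s
𝔑-inverse {n} s = trans (countSubsets-reverse (suc n) (isSubmodule (inverse s)))
                        (countSubsets-cong (suc n) (isSubmodule-inverse s))

𝔑₁-inverse : ∀ {n} (s : StringA n) → 𝔑₁ (inverse s) ≡ submodulesWith s head
𝔑₁-inverse s = trans (submodulesWith-inverse s last) (submodulesWith-cong s last-reverse)

₀𝔑-inverse : ∀ {n} (s : StringA n) → ₀𝔑 (inverse s) ≡ submodulesWith s (not ∘ last)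
₀𝔑-inverse s = trans (submodulesWith-inverse s (not ∘ head)) (submodulesWith-cong s (cong not ∘ head-reverse))

₀𝔑₁-inverse : ∀ {n} (s : StringA n) → ₀𝔑₁ (inverse s) ≡ submodulesWith s (λ S → head S ∧ not (last S))
₀𝔑₁-inverse s = trans (submodulesWith-inverse s (λ S → last S ∧ not (head S)))
  (submodulesWith-cong s (λ S → cong₂ _∧_ (last-reverse S) (cong not (head-reverse S))))

𝔑-split-head : ∀ {n} (s : StringA n) → 𝔑 s ≡ submodulesWith s head ℕ.+ ₀𝔑 s
𝔑-split-head {n} s = count-split (isSubmodule s) head (allSubsets (suc n))

𝔑-split-last : ∀ {n} (s : StringA n) → 𝔑 s ≡ 𝔑₁ s ℕ.+ submodulesWith s (not ∘ last)
𝔑-split-last {n} s = count-split (isSubmodule s) last (allSubsets (suc n))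

𝔑₁-split-head : ∀ {n} (s : StringA n) → 𝔑₁ s ≡ submodulesWith s (λ S → head S ∧ last S) ℕ.+ ₀𝔑₁ s
𝔑₁-split-head s = trans (submodulesWith-split s last head)
  (cong (ℕ._+ ₀𝔑₁ s) (submodulesWith-cong s (λ S → ∧-comm (last S) (head S))))

-- Each hypothesis has a variable on the left, so matching it against refl leaves a ring
-- identity in ℤ once +_ is pushed through the sums.
neg-as-difference : ∀ {a} x c → a ≡ x ℕ.+ c → - (+ x) ≡ + c - + a
neg-as-difference x c refl rewrite pos-+ x c = ring (+ x) (+ c)
  where
  ring : ∀ x c → - x ≡ c - (x + c)
  ring = solve-∀

pos-as-difference : ∀ {a} b y → a ≡ b ℕ.+ y → + y ≡ + a - + b
pos-as-difference b y refl rewrite pos-+ b y = ring (+ b) (+ y)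
  where
  ring : ∀ b y → y ≡ (b + y) - b
  ring = solve-∀

inclusion-exclusion : ∀ {a b x} w z c d → a ≡ x ℕ.+ c → x ≡ w ℕ.+ z → b ≡ w ℕ.+ d →
                      - (+ z) ≡ + c + + b - + a - + d
inclusion-exclusion w z c d refl refl refl
  rewrite pos-+ (w ℕ.+ z) c | pos-+ w z | pos-+ w d = ring (+ w) (+ z) (+ c) (+ d)
  where
  ring : ∀ w z c d → - z ≡ c + (w + d) - ((w + z) + c) - d
  ring = solve-∀

mat-cong : ∀ {p q r t p′ q′ r′ t′} → p ≡ p′ → q ≡ q′ → r ≡ r′ → t ≡ t′ → mat p q r t ≡ mat p′ q′ r′ t′
mat-cong refl refl refl refl = refl

∇-injective : ∀ {n} (s : StringA n) {a b c d} → ∇ s ≡ mat (+ a) (- (+ b)) (+ c) (- (+ d)) →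
              𝔑 s ≡ a × 𝔑₁ s ≡ b × ₀𝔑 s ≡ c × ₀𝔑₁ s ≡ d
∇-injective s eq =
  +-injective (cong (head ∘ head) eq) ,
  +-injective (neg-injective (cong (head ∘ Vec.tail ∘ head) eq)) ,
  +-injective (cong (head ∘ head ∘ Vec.tail) eq) ,
  +-injective (neg-injective (cong (head ∘ Vec.tail ∘ head ∘ Vec.tail) eq))

∇-inverse : ∀ {n} (s : StringA n) →
            ∇ (inverse s) ≡ mat (+ 𝔑 s) (+ ₀𝔑 s - + 𝔑 s) (+ 𝔑 s - + 𝔑₁ s) (+ ₀𝔑 s + + 𝔑₁ s - + 𝔑 s - + ₀𝔑₁ s)
∇-inverse s = mat-cong
  (cong +_ (𝔑-inverse s))
  (trans (cong (-_ ∘ +_) (𝔑₁-inverse s)) (neg-as-difference _ (₀𝔑 s) (𝔑-split-head s)))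
  (trans (cong +_ (₀𝔑-inverse s)) (pos-as-difference (𝔑₁ s) _ (𝔑-split-last s)))
  (trans (cong (-_ ∘ +_) (₀𝔑₁-inverse s))
         (inclusion-exclusion _ _ (₀𝔑 s) (₀𝔑₁ s)
           (𝔑-split-head s) (submodulesWith-split s head last) (𝔑₁-split-head s)))

lemma4p19 : (n : ℕ) (β : StringA n) (a b c d : ℕ)
    → ∇ β ≡ mat (+ a) (- (+ b)) (+ c) (- (+ d))
    → ∇ (inverse β) ≡ mat (+ a) (+ c - + a) (+ a - + b) (+ c + + b - + a - + d)
lemma4p19 n β a b c d eq with ∇-injective β eq
... | refl , refl , refl , refl = ∇-inverse β
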